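{- Let $\tau=\{s,x_1,\dots,x_n\}$ and $\sigma=\{X_1,\dots,X_n\}$, where $s$ is a binary second-order variable, $x_1,\dots,x_n$ are first-order variables and $X_1,\dots,X_n$ are monadic second-order variables. For every $\mathrm{FO}(\mathrm{1TC})$-formula $\varphi$ over $\tau$ there is an $\mathrm{MSO}(\mathrm{TC})$-formula $\varphi^+$ over $\sigma$ such that $(A,I)\models\varphi \iff (B,J)\models\varphi^+$ for all structures $(A,I)$ over $\tau$ and $(B,J)$ over $\sigma$ such that $A=\{0,\dots,m\}$ for some $m\in\mathbb N$, $I(s)$ is the canonical successor relation on $A$, $|B|=m$, and $|J(X_i)|=I(x_i)$ for $1\le i\le n$.
   Context: Structures are pairs $(A,I)$ with $A$ finite nonempty, first-order variables interpreted as elements and $k$-ary second-order variables as subsets of $A^k$. $\mathrm{FO}(\mathrm{1TC})$: first-order logic (atoms $x=y$, $X(x_1,\dots,x_k)$; $\neg,\lor,\exists x$) extended with $[\mathrm{TC}_{\vec x,\vec x'}\varphi](\vec y,\vec y')$ where $\vec x,\vec x'$ are disjoint tuples of first-order variables of equal length and $\vec y,\vec y'$ tuples of first-order variables of that length; it holds iff $(I(\vec y),I(\vec y'))$ lies in the transitive closure of $\{(\vec a,\vec b)\mid \mathfrak A[\vec a/\vec x,\vec b/\vec x']\models\varphi\}$. $\mathrm{MSO}(\mathrm{TC})$: the analogous logic with first-order variables and monadic second-order variables, second-order quantification $\exists X$ over subsets, and TC-operators $[\mathrm{TC}_{\vec X,\vec X'}\varphi](\vec Y,\vec Y')$ over tuples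 of variables of the same sort (first-order or monadic second-order), interpreted as the transitive closure of $\{(\vec R,\vec R')\mid\mathfrak A[\vec R/\vec X,\vec R'/\vec X']\models\varphi\}$. -}

module Defs where

open import Data.Nat using (ℕ; zero; suc; _+_)
open import Data.Fin using (Fin; toℕ)
open import Data.Bool using (Bool; true; false)
open import Data.Empty using (⊥)
open import Data.Sum using (_⊎_)
open import Data.Product using (Σ)
open import Relation.Nullary using (¬_)
open import Relation.Binary.PropositionalEquality using (_≡_)
open import Relation.Binary.Construct.Closure.Transitive using (TransClosure)
open import Data.Vec.Functional using (Vector; _∷_; _++_)
open import Function.Bundles using (_↔_; Inverse)

-- Well-scoped de Bruijn syntax:
-- FO1TC n = formulas whose free first-order variables are among Fin n.

data FO1TC : ℕ → Set where
  eq  : ∀ {n} → Fin n → Fin n → FO1TC n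
  rel : ∀ {n} → Fin n → Fin n → FO1TC n
  neg : ∀ {n} → FO1TC n → FO1TC n
  or  : ∀ {n} → FO1TC n → FO1TC n → FO1TC n
  ex  : ∀ {n} → FO1TC (suc n) → FO1TC n
  -- [TC_{x⃗,x⃗'} φ](y⃗ , y⃗') with |x⃗| = |x⃗'| = k.  In φ the variables
  -- are: x⃗ (first k), x⃗' (next k), then the n outer variables.
  tc  : ∀ {n} (k : ℕ) → FO1TC ((k + k) + n) →
        Vector (Fin n) k → Vector (Fin n) k → FO1TC n

Sat1 : (A : Set) (S : A → A → Set) → ∀ {n} → Vector A n → FO1TC n → Set
Sat1 A S ρ (eq x y) = ρ x ≡ ρ y
Sat1 A S ρ (rel x y) = S (ρ x) (ρ y)
Sat1 A S ρ (neg φ) = ¬ Sat1 A S ρ φ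
Sat1 A S ρ (or φ ψ) = Sat1 A S ρ φ ⊎ Sat1 A S ρ ψ
Sat1 A S ρ (ex φ) = Σ A (λ a → Sat1 A S (a ∷ ρ) φ)
Sat1 A S ρ (tc k φ ys ys') =
  TransClosure (λ (as bs : Vector A k) → Sat1 A S ((as ++ bs) ++ ρ) φ)
               (λ i → ρ (ys i)) (λ i → ρ (ys' i))

-- MSO(TC) with first-order and monadic second-order variables and no
-- other symbols.  MSOTC p q: free first-order variables among Fin p,
-- free monadic second-order variables among Fin q.

data MSOTC : ℕ → ℕ → Set where
  eq   : ∀ {p q} → Fin p → Fin p → MSOTC p q
  mem  : ∀ {p q} → Fin q → Fin p → MSOTC p q
  neg  : ∀ {p q} → MSOTC p q → MSOTC p q
  or   : ∀ {p q} → MSOTC p q → MSOTC p q → MSOTC p q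
  exFO : ∀ {p q} → MSOTC (suc p) q → MSOTC p q
  exSO : ∀ {p q} → MSOTC p (suc q) → MSOTC p q
  tcFO : ∀ {p q} (k : ℕ) → MSOTC ((k + k) + p) q →
         Vector (Fin p) k → Vector (Fin p) k → MSOTC p q
  tcSO : ∀ {p q} (k : ℕ) → MSOTC p ((k + k) + q) →
         Vector (Fin q) k → Vector (Fin q) k → MSOTC p q

-- Subsets of the universe B are represented by characteristic functions.
Sat2 : (B : Set) → ∀ {p q} → Vector B p → Vector (B → Bool) q →
       MSOTC p q → Set
Sat2 B ρ θ (eq x y) = ρ x ≡ ρ y
Sat2 B ρ θ (mem X x) = θ X (ρ x) ≡ true
Sat2 B ρ θ (neg φ) = ¬ Sat2 B ρ θ φ
Sat2 B ρ θ (or φ ψ) = Sat2 B ρ θ φ ⊎ Sat2 B ρ θ ψ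
Sat2 B ρ θ (exFO φ) = Σ B (λ b → Sat2 B (b ∷ ρ) θ φ)
Sat2 B ρ θ (exSO φ) = Σ (B → Bool) (λ X → Sat2 B ρ (X ∷ θ) φ)
Sat2 B ρ θ (tcFO k φ ys ys') =
  TransClosure (λ (as bs : Vector B k) → Sat2 B ((as ++ bs) ++ ρ) θ φ)
               (λ i → ρ (ys i)) (λ i → ρ (ys' i))
Sat2 B ρ θ (tcSO k φ Ys Ys') =
  TransClosure (λ (Rs Rs' : Vector (B → Bool) k) → Sat2 B ρ ((Rs ++ Rs') ++ θ) φ)
               (λ i → θ (Ys i)) (λ i → θ (Ys' i))

count : ∀ {m} → (Fin m → Bool) → ℕ
count {zero} f = zero
count {suc m} f with f Fin.zero
... | true  = suc (count (λ i → f (Fin.suc i)))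
... | false = count (λ i → f (Fin.suc i))

card : ∀ {m} {B : Set} → Fin m ↔ B → (B → Bool) → ℕ
card e X = count (λ i → X (Inverse.to e i))

Succ : ∀ {m} → Fin (suc m) → Fin (suc m) → Set
Succ a b = toℕ b ≡ suc (toℕ a)

noVars : {B : Set} → Vector B 0
noVars ()

-- An element a of {0,…,m} is represented by any subset of B of size a.  Equality and
-- successor of elements then become "same size" and "one element more", and both are
-- MSO(TC)-definable: X and Y have the same size iff both are empty or one can remove an
-- element from each of them simultaneously, repeatedly, until they coincide — a
-- transitive closure over pairs of sets.  First-order quantifiers become monadic
-- second-order ones, and TC over tuples of elements becomes TC over tuples of sets,
-- which is correct because the representation relation is total in both directions.
module Submission where

open import Defs
open import Data.Nat using (ℕ; suc; _<_)
open import Data.Fin using (Fin; toℕ)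
open import Data.Bool using (Bool)
open import Data.Product using (Σ)
open import Relation.Binary.PropositionalEquality using (_≡_)
open import Function.Bundles using (_↔_; _⇔_)

open import Data.Nat using (zero; _≤_; z≤n; s≤s; _<ᵇ_)
open import Data.Nat.Properties using (m≤n⇒m≤1+n; ≤-pred) renaming (_≟_ to _≟ⁿ_; suc-injective to ℕ-suc-injective)
open import Data.Fin using (fromℕ<) renaming (zero to fzero; suc to fsuc)
open import Data.Fin.Properties using (suc-injective; toℕ-injective; toℕ<n; toℕ-fromℕ<; inj⇒≟)
open import Data.Bool using (true; false)
open import Data.Bool.Properties using (¬-not) renaming (_≟_ to _≟ᵇ_)
open import Data.Empty using (⊥-elim)
open import Data.Sum using (_⊎_; inj₁; inj₂)
open import Data.Sum.Function.Propositional using (_⊎-⇔_)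
open import Data.Product using (_×_; _,_; proj₁; proj₂; map; map₂)
open import Function using (_∘_; id; const; flip; case_of_)
open import Function.Bundles using (Inverse; Equivalence; mk⇔)
open import Function.Construct.Identity using (⇔-id)
open import Function.Construct.Symmetry using (⇔-sym; ↔-sym)
open import Function.Construct.Composition using (_⇔-∘_)
open import Function.Properties.Inverse using (↔⇒↣)
open import Function.Related.TypeIsomorphisms using (¬-cong-⇔)
open import Relation.Binary.PropositionalEquality using (refl; sym; trans; cong; _≢_)
open import Relation.Binary.Construct.Closure.Transitive using (TransClosure; [_]; _∷_)
open import Relation.Nullary using (¬_; Dec; yes; no; Stable; decidable-stable; negated-stable; map′; ¬?; _×-dec_; _→-dec_)
open import Data.Vec.Functional using (Vector; _++_; []; replicate) renaming (_∷_ to _∷ᵛ_)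
open import Data.Vec.Functional.Relation.Binary.Pointwise using (Pointwise)
open import Data.Vec.Functional.Relation.Binary.Pointwise.Properties using (++⁺)

open Equivalence using (to; from)

private
  variable
    m n p q k c : ℕ
    A A′ B : Set
    P Q : Set

⇔-true⇒≡ : {u v : Bool} → (u ≡ true ⇔ v ≡ true) → u ≡ v
⇔-true⇒≡ {true}          u⇔v = sym (to u⇔v refl)
⇔-true⇒≡ {false} {false} _   = refl
⇔-true⇒≡ {false} {true}  u⇔v = from u⇔v refl

_⇔-dec_ : Dec P → Dec Q → Dec (P ⇔ Q)
P? ⇔-dec Q? = map′ (λ (f , g) → mk⇔ f g) (λ P⇔Q → to P⇔Q , from P⇔Q) ((P? →-dec Q?) ×-dec (Q? →-dec P?))

×-stable : Stable P → Stable Q → Stable (P × Q)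
×-stable stP stQ ¬¬pq = stP (λ ¬p → ¬¬pq (¬p ∘ proj₁)) , stQ (λ ¬q → ¬¬pq (¬q ∘ proj₂))

∀-stable : {P : A → Set} → (∀ a → Stable (P a)) → Stable (∀ a → P a)
∀-stable stP ¬¬∀ a = stP a (λ ¬pa → ¬¬∀ (λ ∀p → ¬pa (∀p a)))

TransClosure-map : {R R′ : A → A → Set} → (∀ {a b} → R a b → R′ a b) →
                   ∀ {a b} → TransClosure R a b → TransClosure R′ a b
TransClosure-map f [ r ]    = [ f r ]
TransClosure-map f (r ∷ rs) = f r ∷ TransClosure-map f rs

TransClosure-backward : {R : A → A → Set} (I : A → Set) → (∀ {a b} → R a b → I b → I a) →
                        ∀ {a b} → TransClosure R a b → I b → I a
TransClosure-backward I step [ r ]    = step r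
TransClosure-backward I step (r ∷ rs) = step r ∘ TransClosure-backward I step rs

module Correspondence (C : A → A′ → Set)
                      (left-total : ∀ a → Σ A′ (C a))
                      (right-total : ∀ a′ → Σ A (flip C a′)) where

  Σ-⇔ : {P : A → Set} {P′ : A′ → Set} → (∀ {a a′} → C a a′ → P a ⇔ P′ a′) → Σ A P ⇔ Σ A′ P′
  Σ-⇔ P⇔P′ = mk⇔
    (λ (a , pa) → let (a′ , c) = left-total a in a′ , to (P⇔P′ c) pa)
    (λ (a′ , pa′) → let (a , c) = right-total a′ in a , from (P⇔P′ c) pa′)

  TransClosure-⇔ : {R : A → A → Set} {R′ : A′ → A′ → Set} →
                   (∀ {a b a′ b′} → C a a′ → C b b′ → R a b ⇔ R′ a′ b′) →
                   ∀ {a b a′ b′} → C a a′ → C b b′ → TransClosure R a b ⇔ TransClosure R′ a′ b′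
  TransClosure-⇔ {R} {R′} R⇔R′ ca cb = mk⇔ (forth ca cb) (back ca cb)
    where
    forth : ∀ {a b a′ b′} → C a a′ → C b b′ → TransClosure R a b → TransClosure R′ a′ b′
    forth ca cb [ r ] = [ to (R⇔R′ ca cb) r ]
    forth ca cb (_∷_ {y = a₁} r rs) =
      let (a₁′ , c₁) = left-total a₁ in to (R⇔R′ ca c₁) r ∷ forth c₁ cb rs
    back : ∀ {a b a′ b′} → C a a′ → C b b′ → TransClosure R′ a′ b′ → TransClosure R a b
    back ca cb [ r′ ] = [ from (R⇔R′ ca cb) r′ ]
    back ca cb (_∷_ {y = a₁′} r′ rs′) =
      let (a₁ , c₁) = right-total a₁′ in from (R⇔R′ ca c₁) r′ ∷ back c₁ cb rs′

Pointwise-total : {C : A → A′ → Set} → (∀ a → Σ A′ (C a)) →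
                  (as : Vector A k) → Σ (Vector A′ k) (Pointwise C as)
Pointwise-total total as = (λ i → proj₁ (total (as i))) , (λ i → proj₂ (total (as i)))

count-cong : {f g : Fin m → Bool} → (∀ i → f i ≡ g i) → count f ≡ count g
count-cong {zero}  f≗g = refl
count-cong {suc m} {f} {g} f≗g with f fzero | g fzero | f≗g fzero
... | true  | .true  | refl = cong suc (count-cong (f≗g ∘ fsuc))
... | false | .false | refl = count-cong (f≗g ∘ fsuc)

count≤ : (f : Fin m → Bool) → count f ≤ m
count≤ {zero}  f = z≤n
count≤ {suc m} f with f fzero
... | true  = s≤s (count≤ (f ∘ fsuc))
... | false = m≤n⇒m≤1+n (count≤ (f ∘ fsuc))

count-<ᵇ : ∀ {a} → a ≤ m → count {m} (λ i → toℕ i <ᵇ a) ≡ a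
count-<ᵇ {zero}  z≤n       = refl
count-<ᵇ {suc m} {zero}  _ = count-<ᵇ {m} z≤n
count-<ᵇ {suc m} {suc a} (s≤s a≤m) = cong suc (count-<ᵇ a≤m)

count-remove : (f g : Fin m → Bool) (j : Fin m) → f j ≡ true → g j ≡ false →
               (∀ i → i ≢ j → f i ≡ g i) → count f ≡ suc (count g)
count-remove f g fzero fj gj f≗g with f fzero | g fzero
... | true  | false = cong suc (count-cong (λ i → f≗g (fsuc i) (λ ())))
count-remove f g (fsuc j) fj gj f≗g with f fzero | g fzero | f≗g fzero (λ ())
... | true  | .true  | refl =
  cong suc (count-remove (f ∘ fsuc) (g ∘ fsuc) j fj gj (λ i i≢j → f≗g (fsuc i) (i≢j ∘ suc-injective)))
... | false | .false | refl =
  count-remove (f ∘ fsuc) (g ∘ fsuc) j fj gj (λ i i≢j → f≗g (fsuc i) (i≢j ∘ suc-injective))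

count≡suc⇒∃ : (f : Fin m → Bool) → count f ≡ suc c → Σ (Fin m) (λ j → f j ≡ true)
count≡suc⇒∃ {suc m} f h with f fzero in f0
... | true  = fzero , f0
... | false = map fsuc id (count≡suc⇒∃ (f ∘ fsuc) h)

count≡0⇔ : (f : Fin m → Bool) → count f ≡ 0 ⇔ (∀ i → f i ≢ true)
count≡0⇔ f = mk⇔ (forth f) (back f)
  where
  forth : (f : Fin m → Bool) → count f ≡ 0 → ∀ i → f i ≢ true
  forth {suc m} f h i with f fzero in f0
  forth {suc m} f () i | true
  forth {suc m} f h fzero    | false = λ f0≡true → case trans (sym f0) f0≡true of λ ()
  forth {suc m} f h (fsuc i) | false = forth (f ∘ fsuc) h i
  back : (f : Fin m → Bool) → (∀ i → f i ≢ true) → count f ≡ 0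
  back {zero}  f _ = refl
  back {suc m} f h with f fzero in f0
  ... | true  = ⊥-elim (h fzero f0)
  ... | false = back (f ∘ fsuc) (h ∘ fsuc)

infixr 6 _∧ᶠ_
infix  5 _⇔ᶠ_

_∧ᶠ_ : MSOTC p q → MSOTC p q → MSOTC p q
φ ∧ᶠ ψ = neg (or (neg φ) (neg ψ))

_⇔ᶠ_ : MSOTC p q → MSOTC p q → MSOTC p q
φ ⇔ᶠ ψ = or (φ ∧ᶠ ψ) (neg φ ∧ᶠ neg ψ)

∀ᶠ : MSOTC (suc p) q → MSOTC p q
∀ᶠ φ = neg (exFO (neg φ))

-- A record rather than a bare  Sat2 B ρ θ φ ⇔ P  so that ρ, θ and φ are inferable.
record Expresses (ρ : Vector B p) (θ : Vector (B → Bool) q) (φ : MSOTC p q) (P : Set) : Set where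
  constructor expresses
  field meaning : Sat2 B ρ θ φ ⇔ P

open Expresses

Expresses-⇔ : ∀ {ρ : Vector B p} {θ : Vector (B → Bool) q} {φ} →
              Expresses ρ θ φ P → P ⇔ Q → Expresses ρ θ φ Q
Expresses-⇔ (expresses φ⇔P) P⇔Q = expresses (P⇔Q ⇔-∘ φ⇔P)

module _ {ρ : Vector B p} {θ : Vector (B → Bool) q} where

  or-expresses : ∀ {φ ψ} → Expresses ρ θ φ P → Expresses ρ θ ψ Q → Expresses ρ θ (or φ ψ) (P ⊎ Q)
  or-expresses (expresses φ⇔P) (expresses ψ⇔Q) = expresses (φ⇔P ⊎-⇔ ψ⇔Q)

  mem-expresses : ∀ {X x} → Expresses ρ θ (mem X x) (θ X (ρ x) ≡ true)
  mem-expresses = expresses (⇔-id _)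

  ≢-expresses : ∀ {x y} → Expresses ρ θ (neg (eq x y)) (ρ x ≢ ρ y)
  ≢-expresses = expresses (⇔-id _)

  neg-expresses : ∀ {φ} → Expresses ρ θ φ P → Expresses ρ θ (neg φ) (¬ P)
  neg-expresses (expresses φ⇔P) = expresses (¬-cong-⇔ φ⇔P)

  ∧ᶠ-expresses : ∀ {φ ψ} → Stable P → Stable Q →
                 Expresses ρ θ φ P → Expresses ρ θ ψ Q → Expresses ρ θ (φ ∧ᶠ ψ) (P × Q)
  ∧ᶠ-expresses stP stQ (expresses φ⇔P) (expresses ψ⇔Q) = expresses (mk⇔
    (λ h → stP (λ ¬p → h (inj₁ (¬p ∘ to φ⇔P))) , stQ (λ ¬q → h (inj₂ (¬q ∘ to ψ⇔Q))))
    (λ (p , q) → λ { (inj₁ ¬φ) → ¬φ (from φ⇔P p) ; (inj₂ ¬ψ) → ¬ψ (from ψ⇔Q q) }))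

  ⇔ᶠ-expresses : ∀ {P Q φ ψ} → Dec P → Dec Q →
                 Expresses ρ θ φ P → Expresses ρ θ ψ Q → Expresses ρ θ (φ ⇔ᶠ ψ) (P ⇔ Q)
  ⇔ᶠ-expresses {P} {Q} {φ} {ψ} P? Q? φ≈P ψ≈Q = expresses (mk⇔ forth back)
    where
    both : Sat2 B ρ θ (φ ∧ᶠ ψ) ⇔ (P × Q)
    both = meaning (∧ᶠ-expresses (decidable-stable P?) (decidable-stable Q?) φ≈P ψ≈Q)
    neither : Sat2 B ρ θ (neg φ ∧ᶠ neg ψ) ⇔ (¬ P × ¬ Q)
    neither = meaning (∧ᶠ-expresses negated-stable negated-stable (neg-expresses φ≈P) (neg-expresses ψ≈Q))
    forth : Sat2 B ρ θ (φ ⇔ᶠ ψ) → P ⇔ Q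
    forth (inj₁ h) = let (p , q) = to both h in mk⇔ (const q) (const p)
    forth (inj₂ h) = let (¬p , ¬q) = to neither h in mk⇔ (⊥-elim ∘ ¬p) (⊥-elim ∘ ¬q)
    back : P ⇔ Q → Sat2 B ρ θ (φ ⇔ᶠ ψ)
    back P⇔Q = case P? of λ where
      (yes p) → inj₁ (from both (p , to P⇔Q p))
      (no ¬p) → inj₂ (from neither (¬p , ¬p ∘ from P⇔Q))

  ∃ᶠ-expresses : ∀ {φ} {P : B → Set} →
                 (∀ b → Expresses (b ∷ᵛ ρ) θ φ (P b)) → Expresses ρ θ (exFO φ) (Σ B P)
  ∃ᶠ-expresses φ≈P = expresses (mk⇔ (map₂ (to (meaning (φ≈P _)))) (map₂ (from (meaning (φ≈P _)))))

  ∃ˢ-expresses : ∀ {φ} {P : (B → Bool) → Set} →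
                 (∀ X → Expresses ρ (X ∷ᵛ θ) φ (P X)) → Expresses ρ θ (exSO φ) (Σ (B → Bool) P)
  ∃ˢ-expresses φ≈P = expresses (mk⇔ (map₂ (to (meaning (φ≈P _)))) (map₂ (from (meaning (φ≈P _)))))

  tcSO-expresses : ∀ {φ Xs Ys} {R : Vector (B → Bool) k → Vector (B → Bool) k → Set} →
                   (∀ XY XY′ → Expresses ρ ((XY ++ XY′) ++ θ) φ (R XY XY′)) →
                   Expresses ρ θ (tcSO k φ Xs Ys) (TransClosure R (θ ∘ Xs) (θ ∘ Ys))
  tcSO-expresses φ≈R = expresses (mk⇔ (TransClosure-map (to (meaning (φ≈R _ _))))
                                      (TransClosure-map (from (meaning (φ≈R _ _)))))

  ∀ᶠ-expresses : ∀ {φ} {P : B → Set} → (∀ b → Stable (P b)) →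
                 (∀ b → Expresses (b ∷ᵛ ρ) θ φ (P b)) → Expresses ρ θ (∀ᶠ φ) (∀ b → P b)
  ∀ᶠ-expresses stP φ≈P = expresses (mk⇔
    (λ h b → stP b (λ ¬pb → h (b , ¬pb ∘ to (meaning (φ≈P b)))))
    (λ ∀p (b , ¬φ) → ¬φ (from (meaning (φ≈P b)) (∀p b))))

minusᶠ : Fin q → Fin q → Fin p → MSOTC p q
minusᶠ X′ X x = ∀ᶠ (mem X′ fzero ⇔ᶠ mem X fzero ∧ᶠ neg (eq fzero (fsuc x)))

deletionᶠ : Fin q → Fin p → Fin q → MSOTC p q
deletionᶠ X x X′ = mem X x ∧ᶠ minusᶠ X′ X x

emptyᶠ : Fin q → MSOTC p q
emptyᶠ X = ∀ᶠ (neg (mem X fzero))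

stepᶠ : {p q : ℕ} → MSOTC p (suc (suc (suc (suc q))))
stepᶠ {p} {q} = exFO (exFO (deletionᶠ X x X′ ∧ᶠ deletionᶠ Y y Y′))
  where
  X Y X′ Y′ : Fin (suc (suc (suc (suc q))))
  X = fzero ; Y = fsuc fzero ; X′ = fsuc (fsuc fzero) ; Y′ = fsuc (fsuc (fsuc fzero))
  x y : Fin (suc (suc p))
  x = fsuc fzero ; y = fzero

sameCardᶠ : Fin q → Fin q → MSOTC p q
sameCardᶠ X Y = or (emptyᶠ X ∧ᶠ emptyᶠ Y)
                   (exSO (tcSO 2 stepᶠ (fsuc X ∷ᵛ fsuc Y ∷ᵛ []) (replicate 2 fzero)))

sucCardᶠ : Fin q → Fin q → MSOTC p q
sucCardᶠ X Y = exSO (exFO (deletionᶠ (fsuc Y) fzero fzero ∧ᶠ sameCardᶠ fzero (fsuc X)))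

translate : FO1TC n → MSOTC 0 n
translate (eq x y)        = sameCardᶠ x y
translate (rel x y)       = sucCardᶠ x y
translate (neg φ)         = neg (translate φ)
translate (or φ ψ)        = or (translate φ) (translate ψ)
translate (ex φ)          = exSO (translate φ)
translate (tc k φ ys ys′) = tcSO k (translate φ) ys ys′

module _ (e : Fin m ↔ B) where

  open Inverse e using ()
    renaming (to to enum; from to index; strictlyInverseˡ to enum∘index; strictlyInverseʳ to index∘enum)

  _≟ᴮ_ : (a b : B) → Dec (a ≡ b)
  _≟ᴮ_ = inj⇒≟ (↔⇒↣ (↔-sym e))

  ∣_∣ : (B → Bool) → ℕ
  ∣_∣ = card e

  ∅ : B → Bool
  ∅ = const false

  below : ℕ → B → Bool
  below a b = toℕ (index b) <ᵇ a

  _≐_∖_ : (X′ X : B → Bool) → B → Set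
  X′ ≐ X ∖ x = ∀ b → X′ b ≡ true ⇔ (X b ≡ true × b ≢ x)

  Deletion : (B → Bool) → B → (B → Bool) → Set
  Deletion X x X′ = X x ≡ true × X′ ≐ X ∖ x

  delete : (B → Bool) → B → B → Bool
  delete X x b with b ≟ᴮ x
  ... | yes _ = false
  ... | no  _ = X b

  delete-≐ : ∀ X x → delete X x ≐ X ∖ x
  delete-≐ X x b with b ≟ᴮ x
  ... | yes b≡x = mk⇔ (λ ()) (λ (_ , b≢x) → ⊥-elim (b≢x b≡x))
  ... | no  b≢x = mk⇔ (_, b≢x) proj₁

  ∈∖? : (X : B → Bool) (x b : B) → Dec (X b ≡ true × b ≢ x)
  ∈∖? X x b = (X b ≟ᵇ true) ×-dec ¬? (b ≟ᴮ x)

  ≐-stable : ∀ {X′ X x} → Stable (X′ ≐ X ∖ x)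
  ≐-stable {X′} {X} {x} = ∀-stable (λ b → decidable-stable ((X′ b ≟ᵇ true) ⇔-dec ∈∖? X x b))

  deletion-stable : ∀ {X x X′} → Stable (Deletion X x X′)
  deletion-stable {X} {x} = ×-stable (decidable-stable (X x ≟ᵇ true)) ≐-stable

  card≤ : ∀ X → ∣ X ∣ ≤ m
  card≤ X = count≤ (X ∘ enum)

  card-below : ∀ {a} → a ≤ m → ∣ below a ∣ ≡ a
  card-below {a} a≤m =
    trans (count-cong (λ i → cong (λ j → toℕ j <ᵇ a) (index∘enum i))) (count-<ᵇ a≤m)

  card-deletion : ∀ {X x X′} → Deletion X x X′ → ∣ X ∣ ≡ suc ∣ X′ ∣
  card-deletion {X} {x} {X′} (Xx , X′≐) =
    count-remove (X ∘ enum) (X′ ∘ enum) (index x)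
      (trans (cong X (enum∘index x)) Xx) (trans (cong X′ (enum∘index x)) X′x≡false) agree
    where
    X′x≡false : X′ x ≡ false
    X′x≡false = ¬-not (λ X′x → proj₂ (to (X′≐ x) X′x) refl)
    agree : ∀ i → i ≢ index x → X (enum i) ≡ X′ (enum i)
    agree i i≢x = ⇔-true⇒≡ (mk⇔ (λ Xi → from (X′≐ (enum i)) (Xi , enum-i≢x)) (proj₁ ∘ to (X′≐ (enum i))))
      where
      enum-i≢x : enum i ≢ x
      enum-i≢x enumi≡x = i≢x (trans (sym (index∘enum i)) (cong index enumi≡x))

  card≡0⇔ : ∀ X → ∣ X ∣ ≡ 0 ⇔ (∀ b → X b ≢ true)
  card≡0⇔ X = mk⇔
    (λ h b Xb → to (count≡0⇔ (X ∘ enum)) h (index b) (trans (cong X (enum∘index b)) Xb))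
    (λ h → from (count≡0⇔ (X ∘ enum)) (h ∘ enum))

  card≡suc⇒deletion : ∀ {X c} → ∣ X ∣ ≡ suc c →
                      Σ B λ x → Deletion X x (delete X x) × ∣ delete X x ∣ ≡ c
  card≡suc⇒deletion {X} h =
    let (i , Xi) = count≡suc⇒∃ (X ∘ enum) h
        d = Xi , delete-≐ X (enum i)
    in enum i , d , ℕ-suc-injective (trans (sym (card-deletion d)) h)

  ∅-≐ : ∀ {X′ X x} → ∣ X′ ∣ ≡ 0 → X′ ≐ X ∖ x → ∅ ≐ X ∖ x
  ∅-≐ {X′} X′-empty X′≐ b =
    mk⇔ (λ ()) (λ b∈ → ⊥-elim (to (card≡0⇔ X′) X′-empty b (from (X′≐ b) b∈)))

  Step : Vector (B → Bool) 2 → Vector (B → Bool) 2 → Set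
  Step XY XY′ = Σ B λ x → Σ B λ y →
    Deletion (XY fzero) x (XY′ fzero) × Deletion (XY (fsuc fzero)) y (XY′ (fsuc fzero))

  SameSize : Vector (B → Bool) 2 → Set
  SameSize XY = ∣ XY fzero ∣ ≡ ∣ XY (fsuc fzero) ∣

  Step-backward : ∀ {XY XY′} → Step XY XY′ → SameSize XY′ → SameSize XY
  Step-backward (_ , _ , dX , dY) h = trans (card-deletion dX) (trans (cong suc h) (sym (card-deletion dY)))

  countdown : ∀ {XY} c → ∣ XY fzero ∣ ≡ suc c → ∣ XY (fsuc fzero) ∣ ≡ suc c →
              TransClosure Step XY (replicate 2 ∅)
  countdown {XY} c ∣X∣ ∣Y∣ with card≡suc⇒deletion ∣X∣ | card≡suc⇒deletion ∣Y∣
  ... | x , (Xx , X′≐) , ∣X′∣ | y , (Yy , Y′≐) , ∣Y′∣ with c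
  ...   | zero  = [ x , y , (Xx , ∅-≐ ∣X′∣ X′≐) , (Yy , ∅-≐ ∣Y′∣ Y′≐) ]
  ...   | suc _ = (x , y , (Xx , X′≐) , (Yy , Y′≐)) ∷ countdown {XY′} _ ∣X′∣ ∣Y′∣
    where
    XY′ : Vector (B → Bool) 2
    XY′ = delete (XY fzero) x ∷ᵛ delete (XY (fsuc fzero)) y ∷ᵛ []

  module _ {ρ : Vector B p} {θ : Vector (B → Bool) q} where

    minusᶠ-expresses : ∀ {X′ X x} → Expresses ρ θ (minusᶠ X′ X x) (θ X′ ≐ θ X ∖ ρ x)
    minusᶠ-expresses {X′} {X} {x} = ∀ᶠ-expresses
      (λ b → decidable-stable ((θ X′ b ≟ᵇ true) ⇔-dec ∈∖? (θ X) (ρ x) b))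
      (λ b → ⇔ᶠ-expresses (θ X′ b ≟ᵇ true) (∈∖? (θ X) (ρ x) b) mem-expresses
               (∧ᶠ-expresses (decidable-stable (θ X b ≟ᵇ true)) negated-stable mem-expresses ≢-expresses))

    deletionᶠ-expresses : ∀ {X x X′} → Expresses ρ θ (deletionᶠ X x X′) (Deletion (θ X) (ρ x) (θ X′))
    deletionᶠ-expresses = ∧ᶠ-expresses (decidable-stable (_ ≟ᵇ true)) ≐-stable mem-expresses minusᶠ-expresses

    emptyᶠ-expresses : ∀ {X} → Expresses ρ θ (emptyᶠ X) (∀ b → θ X b ≢ true)
    emptyᶠ-expresses = ∀ᶠ-expresses (λ _ → negated-stable) (λ _ → neg-expresses mem-expresses)

  stepᶠ-expresses : ∀ {ρ : Vector B p} {θ : Vector (B → Bool) q} {XY XY′} →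
                    Expresses ρ ((XY ++ XY′) ++ θ) stepᶠ (Step XY XY′)
  stepᶠ-expresses = ∃ᶠ-expresses λ _ → ∃ᶠ-expresses λ _ →
    ∧ᶠ-expresses deletion-stable deletion-stable deletionᶠ-expresses deletionᶠ-expresses

  module _ {ρ : Vector B p} {θ : Vector (B → Bool) q} where

    sameCardᶠ-expresses : ∀ {X Y} → Expresses ρ θ (sameCardᶠ X Y) (∣ θ X ∣ ≡ ∣ θ Y ∣)
    sameCardᶠ-expresses {X} {Y} = Expresses-⇔ witnesses (mk⇔ forth (back _ refl))
      where
      Witness : Set
      Witness = ((∀ b → θ X b ≢ true) × (∀ b → θ Y b ≢ true)) ⊎
                Σ (B → Bool) λ E → TransClosure Step ((E ∷ᵛ θ) ∘ (fsuc X ∷ᵛ fsuc Y ∷ᵛ [])) (replicate 2 E)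
      witnesses : Expresses ρ θ (sameCardᶠ X Y) Witness
      witnesses = or-expresses
        (∧ᶠ-expresses (∀-stable λ _ → negated-stable) (∀-stable λ _ → negated-stable)
                      emptyᶠ-expresses emptyᶠ-expresses)
        (∃ˢ-expresses λ _ → tcSO-expresses λ _ _ → stepᶠ-expresses)
      forth : Witness → ∣ θ X ∣ ≡ ∣ θ Y ∣
      forth (inj₁ (X-empty , Y-empty)) = trans (from (card≡0⇔ _) X-empty) (sym (from (card≡0⇔ _) Y-empty))
      forth (inj₂ (_ , steps)) =
        TransClosure-backward SameSize (λ {XY} {XY′} → Step-backward {XY} {XY′}) steps refl
      back : ∀ c → ∣ θ Y ∣ ≡ c → ∣ θ X ∣ ≡ ∣ θ Y ∣ → Witness
      back zero    ∣Y∣ X≡Y = inj₁ (to (card≡0⇔ _) (trans X≡Y ∣Y∣) , to (card≡0⇔ _) ∣Y∣)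
      back (suc c) ∣Y∣ X≡Y = inj₂ (∅ , countdown c (trans X≡Y ∣Y∣) ∣Y∣)

  module _ {ρ : Vector B p} {θ : Vector (B → Bool) q} where

    sucCardᶠ-expresses : ∀ {X Y} → Expresses ρ θ (sucCardᶠ X Y) (∣ θ Y ∣ ≡ suc ∣ θ X ∣)
    sucCardᶠ-expresses {X} {Y} = Expresses-⇔ witnesses (mk⇔ forth back)
      where
      witnesses : Expresses ρ θ (sucCardᶠ X Y)
                    (Σ (B → Bool) λ Z → Σ B λ y → Deletion (θ Y) y Z × ∣ Z ∣ ≡ ∣ θ X ∣)
      witnesses = ∃ˢ-expresses λ _ → ∃ᶠ-expresses λ _ →
        ∧ᶠ-expresses deletion-stable (decidable-stable (_ ≟ⁿ _)) deletionᶠ-expresses sameCardᶠ-expresses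
      forth : (Σ (B → Bool) λ Z → Σ B λ y → Deletion (θ Y) y Z × ∣ Z ∣ ≡ ∣ θ X ∣) → ∣ θ Y ∣ ≡ suc ∣ θ X ∣
      forth (_ , _ , d , Z≡X) = trans (card-deletion d) (cong suc Z≡X)
      back : ∣ θ Y ∣ ≡ suc ∣ θ X ∣ → Σ (B → Bool) λ Z → Σ B λ y → Deletion (θ Y) y Z × ∣ Z ∣ ≡ ∣ θ X ∣
      back ∣Y∣ = let (y , d , ∣Y∖y∣) = card≡suc⇒deletion ∣Y∣ in delete (θ Y) y , y , d , ∣Y∖y∣

  _≈_ : Fin (suc m) → (B → Bool) → Set
  a ≈ X = ∣ X ∣ ≡ toℕ a

  represent : ∀ a → Σ (B → Bool) (a ≈_)
  represent a = below (toℕ a) , card-below (≤-pred (toℕ<n a))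

  measure : ∀ X → Σ (Fin (suc m)) (_≈ X)
  measure X = fromℕ< (s≤s (card≤ X)) , sym (toℕ-fromℕ< (s≤s (card≤ X)))

  ≈-≡ : ∀ {a b X Y} → a ≈ X → b ≈ Y → (a ≡ b) ⇔ (∣ X ∣ ≡ ∣ Y ∣)
  ≈-≡ a≈X b≈Y = mk⇔ (λ a≡b → trans a≈X (trans (cong toℕ a≡b) (sym b≈Y)))
                    (λ X≡Y → toℕ-injective (trans (sym a≈X) (trans X≡Y b≈Y)))

  ≈-Succ : ∀ {a b X Y} → a ≈ X → b ≈ Y → Succ a b ⇔ (∣ Y ∣ ≡ suc ∣ X ∣)
  ≈-Succ a≈X b≈Y = mk⇔ (λ b≡1+a → trans b≈Y (trans b≡1+a (cong suc (sym a≈X))))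
                       (λ Y≡1+X → trans (sym b≈Y) (trans Y≡1+X (cong suc a≈X)))

  _∷≈_ : ∀ {a X} {ρ : Vector (Fin (suc m)) n} {θ : Vector (B → Bool) n} →
         a ≈ X → Pointwise _≈_ ρ θ → Pointwise _≈_ (a ∷ᵛ ρ) (X ∷ᵛ θ)
  (a≈X ∷≈ ρ≈θ) fzero    = a≈X
  (a≈X ∷≈ ρ≈θ) (fsuc i) = ρ≈θ i

  open Correspondence _≈_ represent measure using (Σ-⇔)
  open module Tuples {k} = Correspondence (Pointwise _≈_ {k})
    (Pointwise-total represent) (Pointwise-total measure) using (TransClosure-⇔)

  translate-correct : ∀ {n} (φ : FO1TC n) {ρ : Vector (Fin (suc m)) n} {θ : Vector (B → Bool) n} →
                      Pointwise _≈_ ρ θ →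
                      Sat1 (Fin (suc m)) Succ ρ φ ⇔ Sat2 B noVars θ (translate φ)
  translate-correct (eq x y) {θ = θ} ρ≈θ =
    ⇔-sym (meaning (sameCardᶠ-expresses {ρ = noVars})) ⇔-∘ ≈-≡ {X = θ x} {θ y} (ρ≈θ x) (ρ≈θ y)
  translate-correct (rel x y) {θ = θ} ρ≈θ =
    ⇔-sym (meaning (sucCardᶠ-expresses {ρ = noVars})) ⇔-∘ ≈-Succ {X = θ x} {θ y} (ρ≈θ x) (ρ≈θ y)
  translate-correct (neg φ)   ρ≈θ = ¬-cong-⇔ (translate-correct φ ρ≈θ)
  translate-correct (or φ ψ)  ρ≈θ = translate-correct φ ρ≈θ ⊎-⇔ translate-correct ψ ρ≈θ
  translate-correct (ex φ)    ρ≈θ = Σ-⇔ (λ a≈X → translate-correct φ (a≈X ∷≈ ρ≈θ))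
  translate-correct (tc k φ ys ys′) ρ≈θ =
    TransClosure-⇔ (λ as≈Xs bs≈Ys → translate-correct φ (++⁺ _≈_ (++⁺ _≈_ as≈Xs bs≈Ys) ρ≈θ))
                   (ρ≈θ ∘ ys) (ρ≈θ ∘ ys′)

mainTheorem7 : (n : ℕ) (φ : FO1TC n) →
    Σ (MSOTC 0 n) λ φ⁺ →
      (m : ℕ) (I : Fin n → Fin (suc m)) (B : Set) (e : Fin m ↔ B)
      (J : Fin n → B → Bool) →
      0 < m →
      ((i : Fin n) → card e (J i) ≡ toℕ (I i)) →
      (Sat1 (Fin (suc m)) Succ I φ ⇔ Sat2 B noVars J φ⁺)
mainTheorem7 n φ = translate φ , λ m I B e J _ I≈J → translate-correct e φ I≈J
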